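{- The class of normal posets is not axiomatizable by first-order sentences in the signature $\{\leq\}$.
   Context: A binary operation $\cdot$ on a poset $(P,\leq)$ is admissible if for all $x,y\in P$: $x\leq y\iff x\cdot y=x$. A right-normal band is a set with an associative binary operation satisfying $x\cdot x=x$ and $x\cdot y\cdot z=y\cdot x\cdot z$. A poset is normal if it admits an admissible right-normal band operation. -}

module Defs where

open import Data.Nat using (ℕ; zero; suc)
open import Data.Fin using (Fin; zero; suc)
open import Data.Product using (_×_; _,_; Σ; ∃)
open import Data.Empty using (⊥)
open import Relation.Nullary using (¬_)
open import Relation.Binary.PropositionalEquality using (_≡_)
open import Function.Bundles using (_⇔_)

record IsPosetRel {A : Set} (_≤_ : A → A → Set) : Set where
  field
    refl≤  : ∀ x → x ≤ x
    trans≤ : ∀ {x y z} → x ≤ y → y ≤ z → x ≤ z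
    antisym≤ : ∀ {x y} → x ≤ y → y ≤ x → x ≡ y

Admissible : {A : Set} (_≤_ : A → A → Set) (_·_ : A → A → A) → Set
Admissible _≤_ _·_ = ∀ x y → (x ≤ y) ⇔ (x · y ≡ x)

record IsRightNormalBand {A : Set} (_·_ : A → A → A) : Set where
  field
    assoc      : ∀ x y z → (x · y) · z ≡ x · (y · z)
    idem       : ∀ x → x · x ≡ x
    rightNormal : ∀ x y z → (x · y) · z ≡ (y · x) · z

Normal : {A : Set} (_≤_ : A → A → Set) → Set
Normal {A} _≤_ =
  Σ (A → A → A) λ _·_ → IsRightNormalBand _·_ × Admissible _≤_ _·_

-- First-order logic in the signature {≤} (with equality).
-- Variables are de Bruijn indices; Formula n has n free variables.
-- Classically complete connective set: ⊥, atoms, →, ∧, ∀.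

data Formula : ℕ → Set where
  ⊥′   : ∀ {n} → Formula n
  _≤′_ : ∀ {n} → Fin n → Fin n → Formula n
  _≐_  : ∀ {n} → Fin n → Fin n → Formula n
  _⇒_  : ∀ {n} → Formula n → Formula n → Formula n
  _∧′_ : ∀ {n} → Formula n → Formula n → Formula n
  ∀′   : ∀ {n} → Formula (suc n) → Formula n

Sentence : Set
Sentence = Formula 0

_∷ᵉ_ : {A : Set} {n : ℕ} → A → (Fin n → A) → Fin (suc n) → A
(a ∷ᵉ ρ) zero    = a
(a ∷ᵉ ρ) (suc i) = ρ i

-- Tarskian satisfaction.  Atoms are read through double negation so that
-- every formula denotes a ¬¬-stable proposition; classically this is the
-- usual two-valued semantics.
Sat : {A : Set} (_≤_ : A → A → Set) {n : ℕ} → (Fin n → A) → Formula n → Set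
Sat _≤_ ρ ⊥′        = ⊥
Sat _≤_ ρ (i ≤′ j)  = ¬ ¬ (ρ i ≤ ρ j)
Sat _≤_ ρ (i ≐ j)   = ¬ ¬ (ρ i ≡ ρ j)
Sat _≤_ ρ (φ ⇒ ψ)   = Sat _≤_ ρ φ → Sat _≤_ ρ ψ
Sat _≤_ ρ (φ ∧′ ψ)  = Sat _≤_ ρ φ × Sat _≤_ ρ ψ
Sat _≤_ ρ (∀′ φ)    = ∀ a → Sat _≤_ (a ∷ᵉ ρ) φ

_⊨_ : {A : Set} (_≤_ : A → A → Set) → Sentence → Set
_⊨_ _≤_ φ = Sat _≤_ (λ ()) φ

Theory : Set₁
Theory = Sentence → Set

NormalPosetsAxiomatizable : Set₁
NormalPosetsAxiomatizable =
  Σ Theory λ T →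
    (A : Set) (_≤_ : A → A → Set) →
      (IsPosetRel _≤_ × Normal _≤_) ⇔ (∀ φ → T φ → _≤_ ⊨ φ)

{-# OPTIONS --safe #-}
-- ℤ ⊔ ℤ, two disjoint copies of the integers, is normal: the product of two points is
-- the minimum of their coordinates, placed in the component of the right factor.
-- ℤ ⊔ ℤ², whose second component is ℤ × ℤ ordered lexicographically, is not: in any
-- admissible right-normal band, u ↦ u · x maps ↓(x · y) into ↓(y · x) monotonically,
-- with left inverse v ↦ v · y. Taking x in the ℤ component and y in the other one,
-- ↓(x · y) contains a whole block ℤ and so an infinite ascending chain, whereas
-- ↓(y · x) is a down-set of ℤ bounded above and has none.
-- Yet the two posets are elementarily equivalent. For an Ehrenfeucht–Fraïssé game of
-- k rounds it suffices that the chosen points have, pairwise, the same difference when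
-- it is below 2^k within one block, and otherwise the same direction or the same
-- incomparability; each round halves the radius. So every first-order theory of ℤ ⊔ ℤ
-- has the non-normal model ℤ ⊔ ℤ².
module Submission where

open import Data.Bool using (Bool; true; false)
import Data.Bool.Properties as Bool
open import Data.Empty using (⊥; ⊥-elim)
open import Data.Fin using (Fin; zero; suc)
open import Data.Fin.Properties using (any?)
open import Data.Integer
  using ( ℤ; +_; -[1+_]; _+_; _-_; -_; _≤_; _<_; _≤?_; _⊓_; ∣_∣; pred; 0ℤ; 1ℤ
        ; +≤+; +<+; -≤+; nonNegative)
  renaming (suc to sucℤ)
open import Data.Integer.Properties
open import Data.Integer.Tactic.RingSolver using (solve-∀)
open import Data.Nat as ℕ using (ℕ; zero; suc; s≤s; z≤n; _⊔_)
import Data.Nat.Properties as ℕ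
open import Data.Product using (Σ; ∃; _×_; _,_; proj₁; proj₂)
open import Data.Sum as Sum using (_⊎_; inj₁; inj₂)
open import Data.Unit using (⊤; tt)
open import Defs
open import Function.Base using (id; _∘_; flip)
open import Function.Bundles using (_⇔_; mk⇔; Equivalence)
open import Relation.Binary.Definitions using (tri<; tri≈; tri>)
open import Relation.Binary.PropositionalEquality
open import Relation.Nullary using (Dec; yes; no; ¬_)
open import Relation.Nullary.Negation using (¬¬-map)
open import Relation.Unary using (Decidable)

i≤+∣i∣ : ∀ i → i ≤ + ∣ i ∣
i≤+∣i∣ (+ _)    = ≤-refl
i≤+∣i∣ -[1+ _ ] = -≤+

strictlyIncreasing⇒unbounded : (f : ℕ → ℤ) → (∀ j → f j < f (suc j)) →
                               ∀ m → ∃ λ j → m < f j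
strictlyIncreasing⇒unbounded f f↑ m = suc N , (begin-strict
  m                ≡⟨ m≡[m-a]+a m (f 0) ⟩
  (m - f 0) + f 0  ≤⟨ +-monoˡ-≤ (f 0) (i≤+∣i∣ (m - f 0)) ⟩
  + N + f 0        <⟨ +-monoˡ-< (f 0) (+<+ (ℕ.n<1+n N)) ⟩
  + suc N + f 0    ≤⟨ growth (suc N) ⟩
  f (suc N)        ∎)
  where
  open ≤-Reasoning
  N : ℕ
  N = ∣ m - f 0 ∣
  m≡[m-a]+a : ∀ m a → m ≡ (m - a) + a
  m≡[m-a]+a = solve-∀
  growth : ∀ j → + j + f 0 ≤ f j
  growth zero    = ≤-reflexive (+-identityˡ (f 0))
  growth (suc j) = begin
    + suc j + f 0     ≡⟨ suc-+ j (f 0) ⟩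
    sucℤ (+ j + f 0)  ≤⟨ suc-mono (growth j) ⟩
    sucℤ (f j)        ≤⟨ i<j⇒suc[i]≤j (f↑ j) ⟩
    f (suc j)         ∎

empty⊎maximum : ∀ {n} {P : Fin n → Set} {_≼_ : Fin n → Fin n → Set} → Decidable P →
                (∀ {i j} → P i → P j → i ≼ j ⊎ j ≼ i) →
                (∀ {i j k} → i ≼ j → j ≼ k → i ≼ k) → (∀ {i} → i ≼ i) →
                (∀ i → ¬ P i) ⊎ Σ (Fin n) λ m → P m × (∀ j → P j → j ≼ m)
empty⊎maximum {zero} _ _ _ _ = inj₁ λ ()
empty⊎maximum {suc _} P? ≼-total ≼-trans ≼-refl
  with P? zero | empty⊎maximum (P? ∘ suc) ≼-total ≼-trans ≼-refl
... | no ¬p0 | inj₁ none = inj₁ λ { zero p0 → ¬p0 p0 ; (suc j) → none j }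
... | yes p0 | inj₁ none =
  inj₂ (zero , p0 , λ { zero _ → ≼-refl ; (suc j) pj → ⊥-elim (none j pj) })
... | no ¬p0 | inj₂ (m , pm , max) =
  inj₂ (suc m , pm , λ { zero p0 → ⊥-elim (¬p0 p0) ; (suc j) pj → max j pj })
... | yes p0 | inj₂ (m , pm , max) with ≼-total p0 pm
...   | inj₁ 0≼m = inj₂ (suc m , pm , λ { zero _ → 0≼m ; (suc j) pj → max j pj })
...   | inj₂ m≼0 =
  inj₂ (zero , p0 , λ { zero _ → ≼-refl ; (suc j) pj → ≼-trans (max j pj) m≼0 })

-- Admissible right-normal bands

module AdmissibleRightNormalBand {A : Set} {_≤_ : A → A → Set} {_·_ : A → A → A}
  (band : IsRightNormalBand _·_) (admissible : Admissible _≤_ _·_) where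

  open IsRightNormalBand band

  ≤⇒· : ∀ {x y} → x ≤ y → x · y ≡ x
  ≤⇒· {x} {y} = Equivalence.to (admissible x y)

  ·⇒≤ : ∀ {x y} → x · y ≡ x → x ≤ y
  ·⇒≤ {x} {y} = Equivalence.from (admissible x y)

  x·y≤y : ∀ x y → (x · y) ≤ y
  x·y≤y x y = ·⇒≤ (trans (assoc x y y) (cong (x ·_) (idem y)))

  ·-monoˡ-≤ : ∀ x {u w} → u ≤ w → (u · x) ≤ (w · x)
  ·-monoˡ-≤ x {u} {w} u≤w = ·⇒≤ (begin
    (u · x) · (w · x) ≡⟨ assoc (u · x) w x ⟨
    ((u · x) · w) · x ≡⟨ cong (_· x) (rightNormal u x w) ⟩
    ((x · u) · w) · x ≡⟨ cong (_· x) (assoc x u w) ⟩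
    (x · (u · w)) · x ≡⟨ cong (λ v → (x · v) · x) (≤⇒· u≤w) ⟩
    (x · u) · x       ≡⟨ rightNormal x u x ⟩
    (u · x) · x       ≡⟨ assoc u x x ⟩
    u · (x · x)       ≡⟨ cong (u ·_) (idem x) ⟩
    u · x             ∎)
    where open ≡-Reasoning

  ·-retraction : ∀ {x y u} → u ≤ (x · y) → (u · x) · y ≡ u
  ·-retraction {x} {y} {u} u≤xy = trans (assoc u x y) (≤⇒· u≤xy)

  ·-into : ∀ {x y u} → u ≤ (x · y) → (u · x) ≤ (y · x)
  ·-into {x} {y} {u} u≤xy =
    ·⇒≤ (trans (sym (assoc (u · x) y x)) (cong (_· x) (·-retraction u≤xy)))

[i+i]-i≡i : ∀ i → (i + i) - i ≡ i
[i+i]-i≡i = solve-∀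

radius : ℕ → ℤ
radius zero    = 1ℤ
radius (suc k) = radius k + radius k

0<radius : ∀ k → 0ℤ < radius k
0<radius zero    = +<+ (s≤s z≤n)
0<radius (suc k) = +-mono-< (0<radius k) (0<radius k)

-radius<0 : ∀ k → - radius k < 0ℤ
-radius<0 k = neg-mono-< (0<radius k)

radius≰-radius : ∀ k → radius k ≤ - radius k → ⊥
radius≰-radius k = <⇒≱ (<-trans (-radius<0 k) (0<radius k))

-- What a formula of quantifier depth k can know about the position of one point
-- relative to another: the exact difference d if |d| < radius k = 2^k, otherwise
-- only the direction, or that the two points are incomparable.
data Offset : Set where
  near                    : ℤ → Offset
  farAbove farBelow apart : Offset

reverse : Offset → Offset
reverse (near d) = near (- d)
reverse farAbove = farBelow
reverse farBelow = farAbove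
reverse apart    = apart

data Clip (k : ℕ) (e : ℤ) : Offset → Set where
  far-above : radius k ≤ e → Clip k e farAbove
  far-below : e ≤ - radius k → Clip k e farBelow
  within    : - radius k < e → e < radius k → Clip k e (near e)

clip : ℕ → ℤ → Offset
clip k e with radius k ≤? e | e ≤? - radius k
... | yes _ | _     = farAbove
... | no _  | yes _ = farBelow
... | no _  | no _  = near e

clip-view : ∀ k e → Clip k e (clip k e)
clip-view k e with radius k ≤? e | e ≤? - radius k
... | yes r≤e | _        = far-above r≤e
... | no _    | yes e≤-r = far-below e≤-r
... | no r≰e  | no e≰-r  = within (≰⇒> e≰-r) (≰⇒> r≰e)

Clip-functional : ∀ {k e o o′} → Clip k e o → Clip k e o′ → o ≡ o′
Clip-functional     (far-above _)    (far-above _)    = refl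
Clip-functional     (far-below _)    (far-below _)    = refl
Clip-functional     (within _ _)     (within _ _)     = refl
Clip-functional {k} (far-above r≤e)  (far-below e≤-r) = ⊥-elim (radius≰-radius k (≤-trans r≤e e≤-r))
Clip-functional {k} (far-below e≤-r) (far-above r≤e)  = ⊥-elim (radius≰-radius k (≤-trans r≤e e≤-r))
Clip-functional     (far-above r≤e)  (within _ e<r)   = ⊥-elim (≤⇒≯ r≤e e<r)
Clip-functional     (within _ e<r)   (far-above r≤e)  = ⊥-elim (≤⇒≯ r≤e e<r)
Clip-functional     (far-below e≤-r) (within -r<e _)  = ⊥-elim (≤⇒≯ e≤-r -r<e)
Clip-functional     (within -r<e _)  (far-below e≤-r) = ⊥-elim (≤⇒≯ e≤-r -r<e)

clip-unique : ∀ {k e o} → Clip k e o → clip k e ≡ o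
clip-unique {k} {e} = Clip-functional (clip-view k e)

clip-spec : ∀ {k e o} → clip k e ≡ o → Clip k e o
clip-spec {k} {e} refl = clip-view k e

clip≢apart : ∀ {k e} → clip k e ≢ apart
clip≢apart eq with clip-spec eq
... | ()

Clip-neg : ∀ {k e o} → Clip k e o → Clip k (- e) (reverse o)
Clip-neg (far-above r≤e)  = far-below (neg-mono-≤ r≤e)
Clip-neg (far-below e≤-r) = far-above (subst (_≤ _) (neg-involutive _) (neg-mono-≤ e≤-r))
Clip-neg (within -r<e e<r) = within (neg-mono-< e<r) (subst (_ <_) (neg-involutive _) (neg-mono-< -r<e))

clip-neg : ∀ k e → clip k (- e) ≡ reverse (clip k e)
clip-neg k e = clip-unique (Clip-neg (clip-view k e))

reclip : ℕ → ℤ → Offset → Offset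
reclip k d (near e) = clip k (e - d)
reclip k d o        = o

Clip-shift : ∀ {k d e o} → - radius k < d → d < radius k →
             Clip (suc k) e o → Clip k (e - d) (reclip k d o)
Clip-shift {k} {d} {e} -r<d d<r (far-above 2r≤e) = far-above (begin
  radius k                         ≡⟨ [i+i]-i≡i (radius k) ⟨
  (radius k + radius k) - radius k ≤⟨ +-mono-≤ 2r≤e (neg-mono-≤ (<⇒≤ d<r)) ⟩
  e - d                            ∎)
  where open ≤-Reasoning
Clip-shift {k} {d} {e} -r<d d<r (far-below e≤-2r) = far-below (begin
  e - d                                ≤⟨ +-mono-≤ e≤-2r (neg-mono-≤ (<⇒≤ -r<d)) ⟩
  - (radius k + radius k) - - radius k ≡⟨ -[r+r]+r≡-r (radius k) ⟩
  - radius k                           ∎)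
  where
  open ≤-Reasoning
  -[r+r]+r≡-r : ∀ r → - (r + r) - - r ≡ - r
  -[r+r]+r≡-r = solve-∀
Clip-shift {k} {d} {e} -r<d d<r (within _ _) = clip-view k (e - d)

clip-shift : ∀ {k d} e → - radius k < d → d < radius k →
             clip k (e - d) ≡ reclip k d (clip (suc k) e)
clip-shift {k} e -r<d d<r = clip-unique (Clip-shift -r<d d<r (clip-view (suc k) e))

Upward : Offset → Set
Upward (near d) = 0ℤ ≤ d
Upward farAbove = ⊤
Upward farBelow = ⊥
Upward apart    = ⊥

Clip-upward : ∀ {k e o} → Clip k e o → Upward o ⇔ 0ℤ ≤ e
Clip-upward {k} (far-above r≤e)  = mk⇔ (λ _ → ≤-trans (<⇒≤ (0<radius k)) r≤e) (λ _ → tt)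
Clip-upward {k} (far-below e≤-r) =
  mk⇔ ⊥-elim (λ 0≤e → <⇒≱ (-radius<0 k) (≤-trans 0≤e e≤-r))
Clip-upward     (within _ _)     = mk⇔ id id

clip-upward : ∀ k e → Upward (clip k e) ⇔ 0ℤ ≤ e
clip-upward k e = Clip-upward (clip-view k e)

near? : (o : Offset) → Dec (∃ λ d → o ≡ near d)
near? (near d) = yes (d , refl)
near? farAbove = no λ ()
near? farBelow = no λ ()
near? apart    = no λ ()

farAbove? : (o : Offset) → Dec (o ≡ farAbove)
farAbove? (near _) = no λ ()
farAbove? farAbove = yes refl
farAbove? farBelow = no λ ()
farAbove? apart    = no λ ()

farBelow? : (o : Offset) → Dec (o ≡ farBelow)
farBelow? (near _) = no λ ()
farBelow? farAbove = no λ ()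
farBelow? farBelow = yes refl
farBelow? apart    = no λ ()

-- Lexicographic sums of copies of ℤ

data Comparison : Set where
  less equal greater incomparable : Comparison

converse : Comparison → Comparison
converse less         = greater
converse equal        = equal
converse greater      = less
converse incomparable = incomparable

-- Lex B below is the poset Block × ℤ ordered lexicographically, where blocks on the
-- same side form a chain and blocks on different sides are incomparable; the two
-- sides are thus the two components of the poset.
record BlockOrder : Set₁ where
  field
    Block   : Set
    side    : Block → Bool
    compare : Block → Block → Comparison
    compare-refl       : ∀ x → compare x x ≡ equal
    compare-≡          : ∀ {x y} → compare x y ≡ equal → x ≡ y
    compare-converse   : ∀ x y → compare y x ≡ converse (compare x y)
    compare-trans      : ∀ {x y z} → compare x y ≡ less → compare y z ≡ less →
                         compare x z ≡ less
    incomparable⇒side≢ : ∀ {x y} → compare x y ≡ incomparable → side x ≢ side y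
    side≢⇒incomparable : ∀ {x y} → side x ≢ side y → compare x y ≡ incomparable
    blockOn            : Bool → Block
    side-blockOn       : ∀ s → side (blockOn s) ≡ s

LexLeq : Comparison → ℤ → ℤ → Set
LexLeq less         _ _ = ⊤
LexLeq equal        o p = o ≤ p
LexLeq greater      _ _ = ⊥
LexLeq incomparable _ _ = ⊥

offsetBy : Comparison → ℕ → ℤ → Offset
offsetBy less         _ _ = farAbove
offsetBy equal        k e = clip k e
offsetBy greater      _ _ = farBelow
offsetBy incomparable _ _ = apart

module Lex (B : BlockOrder) where
  open BlockOrder B

  Point : Set
  Point = Block × ℤ

  sideOf : Point → Bool
  sideOf = side ∘ proj₁

  shift : Point → ℤ → Point
  shift (x , o) d = x , o + d

  _≼_ : Point → Point → Set
  (x , o) ≼ (y , p) = LexLeq (compare x y) o p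

  offset : ℕ → Point → Point → Offset
  offset k (x , o) (y , p) = offsetBy (compare x y) k (p - o)

  ≼-higher : ∀ {x y o p} → compare x y ≡ less → (x , o) ≼ (y , p)
  ≼-higher xy rewrite xy = tt

  ≼-same : ∀ {x o p} → o ≤ p → (x , o) ≼ (x , p)
  ≼-same {x} o≤p rewrite compare-refl x = o≤p

  ≼-refl : ∀ x → x ≼ x
  ≼-refl _ = ≼-same ≤-refl

  ≼-trans : ∀ {x y z} → x ≼ y → y ≼ z → x ≼ z
  ≼-trans {x , o} {y , p} {z , q} x≼y y≼z with compare x y in xy | compare y z in yz
  ... | less  | less  rewrite compare-trans xy yz = tt
  ... | less  | equal rewrite sym (compare-≡ yz) | xy = tt
  ... | equal | less  rewrite compare-≡ xy | yz = tt
  ... | equal | equal rewrite compare-≡ xy | compare-≡ yz | compare-refl z = ≤-trans x≼y y≼z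

  ≼-antisym : ∀ {x y} → x ≼ y → y ≼ x → x ≡ y
  ≼-antisym {x , o} {y , p} x≼y y≼x
    with compare x y in xy | subst (λ c → LexLeq c p o) (compare-converse x y) y≼x
  ... | equal | p≤o = cong₂ _,_ (compare-≡ xy) (≤-antisym x≼y p≤o)

  ≼-isPoset : IsPosetRel _≼_
  ≼-isPoset = record { refl≤ = ≼-refl ; trans≤ = ≼-trans ; antisym≤ = ≼-antisym }

  ≼-total : ∀ {x y} → sideOf x ≡ sideOf y → x ≼ y ⊎ y ≼ x
  ≼-total {x , o} {y , p} same with compare x y in xy | compare-converse x y
  ... | less         | _   = inj₁ tt
  ... | greater      | yx  rewrite yx = inj₂ tt
  ... | incomparable | _   = ⊥-elim (incomparable⇒side≢ xy same)
  ... | equal        | yx  rewrite yx = ≤-total o p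

  offset-self : ∀ k x → offset k x x ≡ near 0ℤ
  offset-self k (x , o) rewrite compare-refl x | +-inverseʳ o =
    clip-unique (within (-radius<0 k) (0<radius k))

  offset-converse : ∀ k x y → offset k y x ≡ reverse (offset k x y)
  offset-converse k (x , o) (y , p) rewrite compare-converse x y with compare x y
  ... | less         = refl
  ... | greater      = refl
  ... | incomparable = refl
  ... | equal        = trans (cong (clip k) (o-p≡-[p-o] o p)) (clip-neg k (p - o))
    where
    o-p≡-[p-o] : ∀ o p → o - p ≡ - (p - o)
    o-p≡-[p-o] = solve-∀

  offset-shift : ∀ k x z {d} → - radius k < d → d < radius k →
                 offset k (shift x d) z ≡ reclip k d (offset (suc k) x z)
  offset-shift k (x , o) (z , q) {d} -r<d d<r with compare x z
  ... | less         = refl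
  ... | greater      = refl
  ... | incomparable = refl
  ... | equal        = trans (cong (clip k) (q-[o+d]≡[q-o]-d q o d)) (clip-shift (q - o) -r<d d<r)
    where
    q-[o+d]≡[q-o]-d : ∀ q o d → q - (o + d) ≡ (q - o) - d
    q-[o+d]≡[q-o]-d = solve-∀

  shift-zero : ∀ x → shift x 0ℤ ≡ x
  shift-zero (x , o) = cong (x ,_) (+-identityʳ o)

  offset-coarsen : ∀ k x y → offset k x y ≡ reclip k 0ℤ (offset (suc k) x y)
  offset-coarsen k x y =
    subst (λ w → offset k w y ≡ reclip k 0ℤ (offset (suc k) x y)) (shift-zero x)
          (offset-shift k x y (-radius<0 k) (0<radius k))

  offset-near : ∀ {k d} x y → offset k x y ≡ near d →
                y ≡ shift x d × - radius k < d × d < radius k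
  offset-near {k} (x , o) (y , p) eq with compare x y in xy
  ... | equal with compare-≡ xy | clip-spec eq
  ...   | refl | within -r<d d<r = cong (x ,_) (p≡o+[p-o] o p) , -r<d , d<r
    where
    p≡o+[p-o] : ∀ o p → p ≡ o + (p - o)
    p≡o+[p-o] = solve-∀

  ≡⇔offset-near0 : ∀ k x y → x ≡ y ⇔ offset k x y ≡ near 0ℤ
  ≡⇔offset-near0 k x y = mk⇔ (λ { refl → offset-self k x })
    (λ eq → trans (sym (shift-zero x)) (sym (proj₁ (offset-near x y eq))))

  ≼⇔upward : ∀ k x y → x ≼ y ⇔ Upward (offset k x y)
  ≼⇔upward k (x , o) (y , p) with compare x y
  ... | less         = mk⇔ id id
  ... | greater      = mk⇔ id id
  ... | incomparable = mk⇔ id id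
  ... | equal        = mk⇔ (Equivalence.from (clip-upward k (p - o)) ∘ i≤j⇒0≤j-i)
                           (0≤i-j⇒j≤i ∘ Equivalence.to (clip-upward k (p - o)))

  offset-apart⇒side≢ : ∀ {k} x y → offset k x y ≡ apart → sideOf x ≢ sideOf y
  offset-apart⇒side≢ {k} (x , o) (y , p) eq with compare x y in xy
  ... | incomparable = incomparable⇒side≢ xy
  ... | equal        = ⊥-elim (clip≢apart eq)

  side≢⇒offset-apart : ∀ {k} x y → sideOf x ≢ sideOf y → offset k x y ≡ apart
  side≢⇒offset-apart {k} (x , o) (y , p) ne rewrite side≢⇒incomparable ne = refl

  offset≢apart⇒side≡ : ∀ {k} x y → offset k x y ≢ apart → sideOf x ≡ sideOf y
  offset≢apart⇒side≡ {k} x y ne with sideOf x Bool.≟ sideOf y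
  ... | yes same = same
  ... | no  diff = ⊥-elim (ne (side≢⇒offset-apart {k} x y diff))

  data FarAbove (k : ℕ) : Point → Point → Set where
    higher-block : ∀ {x y o p} → compare x y ≡ less → FarAbove k (x , o) (y , p)
    same-block   : ∀ {x o p} → radius k ≤ p - o → FarAbove k (x , o) (x , p)

  FarAbove⇒offset : ∀ {k x y} → FarAbove k x y → offset k x y ≡ farAbove
  FarAbove⇒offset (higher-block xy) rewrite xy = refl
  FarAbove⇒offset (same-block {x} r≤p-o) rewrite compare-refl x = clip-unique (far-above r≤p-o)

  offset⇒FarAbove : ∀ {k x y} → offset k x y ≡ farAbove → FarAbove k x y
  offset⇒FarAbove {k} {x , o} {y , p} eq with compare x y in xy
  ... | less = higher-block xy
  ... | equal with compare-≡ xy | clip-spec eq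
  ...   | refl | far-above r≤p-o = same-block r≤p-o

  FarAbove-trans : ∀ {k x y z} → FarAbove k x y → FarAbove k y z → FarAbove (suc k) x z
  FarAbove-trans (higher-block xy) (higher-block yz) = higher-block (compare-trans xy yz)
  FarAbove-trans (higher-block xy) (same-block _)    = higher-block xy
  FarAbove-trans (same-block _)    (higher-block yz) = higher-block yz
  FarAbove-trans {k} (same-block {o = o} {p} r≤p-o) (same-block {p = q} r≤q-p) = same-block (begin
    radius k + radius k ≤⟨ +-mono-≤ r≤q-p r≤p-o ⟩
    (q - p) + (p - o)   ≡⟨ +-minus-telescope q p o ⟩
    q - o               ∎)
    where open ≤-Reasoning

  FarAbove-shift : ∀ {k x z} → FarAbove (suc k) x z → FarAbove k (shift x (radius k)) z
  FarAbove-shift (higher-block xz) = higher-block xz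
  FarAbove-shift {k} (same-block {o = o} {q} 2r≤q-o) = same-block (begin
    radius k                         ≡⟨ [i+i]-i≡i (radius k) ⟨
    (radius k + radius k) - radius k ≤⟨ +-monoˡ-≤ (- radius k) 2r≤q-o ⟩
    (q - o) - radius k               ≡⟨ [q-o]-r≡q-[o+r] q o (radius k) ⟩
    q - (o + radius k)               ∎)
    where
    open ≤-Reasoning
    [q-o]-r≡q-[o+r] : ∀ q o r → (q - o) - r ≡ q - (o + r)
    [q-o]-r≡q-[o+r] = solve-∀

  ≼⇒FarAbove-shift : ∀ {k y m} → y ≼ m → FarAbove k y (shift m (radius k))
  ≼⇒FarAbove-shift {k} {y , p} {m , q} y≼m with compare y m in ym
  ... | less  = higher-block ym
  ... | equal with compare-≡ ym
  ...   | refl = same-block (begin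
    radius k             ≤⟨ i≤i+j (radius k) (q - p) ⦃ nonNegative (i≤j⇒0≤j-i y≼m) ⦄ ⟩
    radius k + (q - p)   ≡⟨ r+[q-p]≡[q+r]-p (radius k) q p ⟩
    (q + radius k) - p   ∎)
    where
    open ≤-Reasoning
    r+[q-p]≡[q+r]-p : ∀ r q p → r + (q - p) ≡ (q + r) - p
    r+[q-p]≡[q+r]-p = solve-∀

  ≼⇒FarAbove-unshift : ∀ {k m y} → m ≼ y → FarAbove k (shift m (- radius k)) y
  ≼⇒FarAbove-unshift {k} {m , q} {y , p} m≼y with compare m y in my
  ... | less  = higher-block my
  ... | equal with compare-≡ my
  ...   | refl = same-block (begin
    radius k             ≤⟨ i≤i+j (radius k) (p - q) ⦃ nonNegative (i≤j⇒0≤j-i m≼y) ⦄ ⟩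
    radius k + (p - q)   ≡⟨ r+[p-q]≡p-[q-r] (radius k) p q ⟩
    p - (q - radius k)   ∎)
    where
    open ≤-Reasoning
    r+[p-q]≡p-[q-r] : ∀ r p q → r + (p - q) ≡ p - (q - r)
    r+[p-q]≡p-[q-r] = solve-∀

-- The back-and-forth argument

open Lex using (Point; sideOf; offset; shift)

record Equivalent (B B′ : BlockOrder) (k : ℕ) {n : ℕ}
                  (ρ : Fin n → Point B) (σ : Fin n → Point B′) : Set where
  field
    same-side   : ∀ i → sideOf B (ρ i) ≡ sideOf B′ (σ i)
    same-offset : ∀ i j → offset B k (ρ i) (ρ j) ≡ offset B′ k (σ i) (σ j)

open Equivalent

module _ {B B′ : BlockOrder} {n : ℕ} {ρ : Fin n → Point B} {σ : Fin n → Point B′} where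

  Equivalent-sym : ∀ {k} → Equivalent B B′ k ρ σ → Equivalent B′ B k σ ρ
  Equivalent-sym ρ≈σ = record
    { same-side   = λ i → sym (same-side ρ≈σ i)
    ; same-offset = λ i j → sym (same-offset ρ≈σ i j) }

  Equivalent-coarsen : ∀ {k} → Equivalent B B′ (suc k) ρ σ → Equivalent B B′ k ρ σ
  Equivalent-coarsen {k} ρ≈σ = record
    { same-side   = same-side ρ≈σ
    ; same-offset = λ i j → begin
        offset B k (ρ i) (ρ j)
          ≡⟨ Lex.offset-coarsen B k (ρ i) (ρ j) ⟩
        reclip k 0ℤ (offset B (suc k) (ρ i) (ρ j))
          ≡⟨ cong (reclip k 0ℤ) (same-offset ρ≈σ i j) ⟩
        reclip k 0ℤ (offset B′ (suc k) (σ i) (σ j))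
          ≡⟨ Lex.offset-coarsen B′ k (σ i) (σ j) ⟨
        offset B′ k (σ i) (σ j)
          ∎ }
    where open ≡-Reasoning

  Equivalent-≼ : ∀ {k} → Equivalent B B′ k ρ σ → ∀ {i j} →
                 Lex._≼_ B (ρ i) (ρ j) → Lex._≼_ B′ (σ i) (σ j)
  Equivalent-≼ {k} ρ≈σ {i} {j} =
    Equivalence.from (Lex.≼⇔upward B′ k (σ i) (σ j))
    ∘ subst Upward (same-offset ρ≈σ i j)
    ∘ Equivalence.to (Lex.≼⇔upward B k (ρ i) (ρ j))

  Equivalent-≡ : ∀ {k} → Equivalent B B′ k ρ σ → ∀ {i j} → ρ i ≡ ρ j → σ i ≡ σ j
  Equivalent-≡ {k} ρ≈σ {i} {j} =
    Equivalence.from (Lex.≡⇔offset-near0 B′ k (σ i) (σ j))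
    ∘ trans (sym (same-offset ρ≈σ i j))
    ∘ Equivalence.to (Lex.≡⇔offset-near0 B k (ρ i) (ρ j))

module Forth {B B′ : BlockOrder} {n : ℕ} (k : ℕ) {ρ : Fin n → Point B} {σ : Fin n → Point B′}
             (ρ≈σ : Equivalent B B′ (suc k) ρ σ) (a : Point B) where

  private
    module S = Lex B
    module T = Lex B′

  offset-swap : ∀ {m} x y (u v : Point B′) → offset B m x y ≡ offset B′ m u v →
                offset B m y x ≡ offset B′ m v u
  offset-swap {m} x y u v eq = begin
    offset B m y x             ≡⟨ S.offset-converse m x y ⟩
    reverse (offset B m x y)   ≡⟨ cong reverse eq ⟩
    reverse (offset B′ m u v)  ≡⟨ T.offset-converse m u v ⟨
    offset B′ m v u            ∎
    where open ≡-Reasoning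

  Match : Set
  Match = Σ (Point B′) λ b → Equivalent B B′ k (a ∷ᵉ ρ) (b ∷ᵉ σ)

  extend : (b : Point B′) → sideOf B a ≡ sideOf B′ b →
           (∀ j → offset B k (ρ j) a ≡ offset B′ k (σ j) b) → Match
  extend b a~b offsets = b , record { same-side = sides ; same-offset = offsets′ }
    where
    sides : ∀ i → sideOf B ((a ∷ᵉ ρ) i) ≡ sideOf B′ ((b ∷ᵉ σ) i)
    sides zero    = a~b
    sides (suc i) = same-side ρ≈σ i
    offsets′ : ∀ i j → offset B k ((a ∷ᵉ ρ) i) ((a ∷ᵉ ρ) j) ≡
                       offset B′ k ((b ∷ᵉ σ) i) ((b ∷ᵉ σ) j)
    offsets′ zero    zero    = trans (S.offset-self k a) (sym (T.offset-self k b))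
    offsets′ zero    (suc j) = offset-swap (ρ j) a (σ j) b (offsets j)
    offsets′ (suc i) zero    = offsets i
    offsets′ (suc i) (suc j) = same-offset (Equivalent-coarsen ρ≈σ) i j

  side-of-comparable : ∀ j {o} → offset B k (ρ j) a ≡ o → o ≢ apart →
                       sideOf B (ρ j) ≡ sideOf B a
  side-of-comparable j eq o≢apart = S.offset≢apart⇒side≡ (ρ j) a (o≢apart ∘ trans (sym eq))

  comparable-total : ∀ i j {o} → offset B k (ρ i) a ≡ o → offset B k (ρ j) a ≡ o → o ≢ apart →
                     S._≼_ (ρ i) (ρ j) ⊎ S._≼_ (ρ j) (ρ i)
  comparable-total i j ρi-a ρj-a o≢apart = S.≼-total
    (trans (side-of-comparable i ρi-a o≢apart) (sym (side-of-comparable j ρj-a o≢apart)))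

  apart-transport : ∀ j b → sideOf B a ≡ sideOf B′ b →
                    offset B k (ρ j) a ≡ apart → offset B′ k (σ j) b ≡ apart
  apart-transport j b a~b ρj-a = T.side≢⇒offset-apart (σ j) b λ σj~b →
    S.offset-apart⇒side≢ (ρ j) a ρj-a (trans (same-side ρ≈σ j) (trans σj~b (sym a~b)))

  near-match : ∀ i d → offset B k (ρ i) a ≡ near d → Match
  near-match i d ρi-a with S.offset-near (ρ i) a ρi-a
  ... | a≡ρi+d , -r<d , d<r = extend b a~b offsets
    where
    b : Point B′
    b = shift B′ (σ i) d
    a~b : sideOf B a ≡ sideOf B′ b
    a~b = trans (cong (sideOf B) a≡ρi+d) (same-side ρ≈σ i)
    offsets : ∀ j → offset B k (ρ j) a ≡ offset B′ k (σ j) b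
    offsets j = offset-swap a (ρ j) b (σ j) (begin
      offset B k a (ρ j)                           ≡⟨ cong (λ x → offset B k x (ρ j)) a≡ρi+d ⟩
      offset B k (shift B (ρ i) d) (ρ j)           ≡⟨ S.offset-shift k (ρ i) (ρ j) -r<d d<r ⟩
      reclip k d (offset B (suc k) (ρ i) (ρ j))    ≡⟨ cong (reclip k d) (same-offset ρ≈σ i j) ⟩
      reclip k d (offset B′ (suc k) (σ i) (σ j))   ≡⟨ T.offset-shift k (σ i) (σ j) -r<d d<r ⟨
      offset B′ k b (σ j)                          ∎)
      where open ≡-Reasoning

  module _ (no-near : ∀ j d → offset B k (ρ j) a ≢ near d) where

    -- a is more than radius k away from every ρ j. Put b exactly radius k above σ m, for
    -- the greatest ρ m below a: whatever is 2 · radius k above σ m is still far above b.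
    above-match : ∀ m → offset B k (ρ m) a ≡ farAbove →
                  (∀ j → offset B k (ρ j) a ≡ farAbove → S._≼_ (ρ j) (ρ m)) → Match
    above-match m ρm-a greatest = extend b a~b offsets
      where
      b : Point B′
      b = shift B′ (σ m) (radius k)
      a~b : sideOf B a ≡ sideOf B′ b
      a~b = trans (sym (side-of-comparable m ρm-a λ ())) (same-side ρ≈σ m)
      offsets : ∀ j → offset B k (ρ j) a ≡ offset B′ k (σ j) b
      offsets j with offset B k (ρ j) a in ρj-a
      ... | near d   = ⊥-elim (no-near j d ρj-a)
      ... | farAbove =
        sym (T.FarAbove⇒offset (T.≼⇒FarAbove-shift (Equivalent-≼ ρ≈σ (greatest j ρj-a))))
      ... | apart    = sym (apart-transport j b a~b ρj-a)
      ... | farBelow = sym (trans (T.offset-converse k b (σ j))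
                                  (cong reverse (T.FarAbove⇒offset (T.FarAbove-shift σj-above-σm))))
        where
        ρj-above-ρm : S.FarAbove (suc k) (ρ m) (ρ j)
        ρj-above-ρm = S.FarAbove-trans (S.offset⇒FarAbove ρm-a)
          (S.offset⇒FarAbove (trans (S.offset-converse k (ρ j) a) (cong reverse ρj-a)))
        σj-above-σm : T.FarAbove (suc k) (σ m) (σ j)
        σj-above-σm = T.offset⇒FarAbove
          (trans (sym (same-offset ρ≈σ m j)) (S.FarAbove⇒offset ρj-above-ρm))

    below-match : (∀ j → offset B k (ρ j) a ≢ farAbove) →
                  ∀ m → offset B k (ρ m) a ≡ farBelow →
                  (∀ j → offset B k (ρ j) a ≡ farBelow → S._≼_ (ρ m) (ρ j)) → Match
    below-match no-above m ρm-a least = extend b a~b offsets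
      where
      b : Point B′
      b = shift B′ (σ m) (- radius k)
      a~b : sideOf B a ≡ sideOf B′ b
      a~b = trans (sym (side-of-comparable m ρm-a λ ())) (same-side ρ≈σ m)
      offsets : ∀ j → offset B k (ρ j) a ≡ offset B′ k (σ j) b
      offsets j with offset B k (ρ j) a in ρj-a
      ... | near d   = ⊥-elim (no-near j d ρj-a)
      ... | farAbove = ⊥-elim (no-above j ρj-a)
      ... | apart    = sym (apart-transport j b a~b ρj-a)
      ... | farBelow = sym (trans (T.offset-converse k b (σ j))
        (cong reverse (T.FarAbove⇒offset (T.≼⇒FarAbove-unshift (Equivalent-≼ ρ≈σ (least j ρj-a))))))

    isolated-match : (∀ j → offset B k (ρ j) a ≢ farAbove) →
                     (∀ j → offset B k (ρ j) a ≢ farBelow) → Match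
    isolated-match no-above no-below = extend b a~b offsets
      where
      b : Point B′
      b = BlockOrder.blockOn B′ (sideOf B a) , 0ℤ
      a~b : sideOf B a ≡ sideOf B′ b
      a~b = sym (BlockOrder.side-blockOn B′ (sideOf B a))
      offsets : ∀ j → offset B k (ρ j) a ≡ offset B′ k (σ j) b
      offsets j with offset B k (ρ j) a in ρj-a
      ... | near d   = ⊥-elim (no-near j d ρj-a)
      ... | farAbove = ⊥-elim (no-above j ρj-a)
      ... | farBelow = ⊥-elim (no-below j ρj-a)
      ... | apart    = sym (apart-transport j b a~b ρj-a)

    far-match : Match
    far-match with empty⊎maximum (λ j → farAbove? (offset B k (ρ j) a))
                     (λ {i} {j} ρi-a ρj-a → comparable-total i j ρi-a ρj-a λ ())
                     S.≼-trans (S.≼-refl _)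
    ... | inj₂ (m , ρm-a , greatest) = above-match m ρm-a greatest
    ... | inj₁ no-above with empty⊎maximum (λ j → farBelow? (offset B k (ρ j) a))
                     (λ {i} {j} ρi-a ρj-a → Sum.swap (comparable-total i j ρi-a ρj-a λ ()))
                     (flip S.≼-trans) (S.≼-refl _)
    ...   | inj₂ (m , ρm-a , least) = below-match no-above m ρm-a least
    ...   | inj₁ no-below           = isolated-match no-above no-below

  match : Match
  match with any? (λ i → near? (offset B k (ρ i) a))
  ... | yes (i , d , ρi-a) = near-match i d ρi-a
  ... | no none            = far-match (λ j d ρj-a → none (j , d , ρj-a))

depth : ∀ {n} → Formula n → ℕ
depth ⊥′       = 0
depth (_ ≤′ _) = 0
depth (_ ≐ _)  = 0
depth (φ ⇒ ψ)  = depth φ ⊔ depth ψ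
depth (φ ∧′ ψ) = depth φ ⊔ depth ψ
depth (∀′ φ)   = suc (depth φ)

transfer : ∀ {B B′ n k} (φ : Formula n) → depth φ ℕ.≤ k →
           ∀ {ρ σ} → Equivalent B B′ k ρ σ →
           Sat (Lex._≼_ B) ρ φ → Sat (Lex._≼_ B′) σ φ
transfer ⊥′       _ _   ()
transfer (_ ≤′ _) _ ρ≈σ = ¬¬-map (Equivalent-≼ ρ≈σ)
transfer (_ ≐ _)  _ ρ≈σ = ¬¬-map (Equivalent-≡ ρ≈σ)
transfer (φ ⇒ ψ)  d ρ≈σ φ⇒ψ =
  transfer ψ (ℕ.m⊔n≤o⇒n≤o _ _ d) ρ≈σ
  ∘ φ⇒ψ
  ∘ transfer φ (ℕ.m⊔n≤o⇒m≤o _ _ d) (Equivalent-sym ρ≈σ)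
transfer (φ ∧′ ψ) d ρ≈σ (sφ , sψ) =
  transfer φ (ℕ.m⊔n≤o⇒m≤o _ _ d) ρ≈σ sφ ,
  transfer ψ (ℕ.m⊔n≤o⇒n≤o _ _ d) ρ≈σ sψ
transfer (∀′ φ) (s≤s d) ρ≈σ ∀φ b with Forth.match _ (Equivalent-sym ρ≈σ) b
... | a , b≈a = transfer φ d (Equivalent-sym b≈a) (∀φ a)

⊨-transfer : ∀ B B′ φ → Lex._≼_ B ⊨ φ → Lex._≼_ B′ ⊨ φ
⊨-transfer B B′ φ =
  transfer {B} {B′} φ ℕ.≤-refl (record { same-side = λ () ; same-offset = λ () })

-- The two posets

compareBool : Bool → Bool → Comparison
compareBool false false = equal
compareBool true  true  = equal
compareBool _     _     = incomparable

ℤ⊔ℤ : BlockOrder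
ℤ⊔ℤ = record
  { Block              = Bool
  ; side               = id
  ; compare            = compareBool
  ; compare-refl       = λ { false → refl ; true → refl }
  ; compare-≡          = λ { {false} {false} _ → refl ; {true} {true} _ → refl }
  ; compare-converse   = λ { false false → refl ; false true → refl
                           ; true false → refl ; true true → refl }
  ; compare-trans      = λ { {false} {false} () ; {true} {true} () }
  ; incomparable⇒side≢ = λ { {false} {true} _ () ; {true} {false} _ () }
  ; side≢⇒incomparable = λ { {false} {false} ne → ⊥-elim (ne refl) ; {false} {true} _ → refl
                           ; {true} {false} _ → refl ; {true} {true} ne → ⊥-elim (ne refl) }
  ; blockOn            = id
  ; side-blockOn       = λ _ → refl
  }

compareℤ : ℤ → ℤ → Comparison
compareℤ i j with <-cmp i j
... | tri< _ _ _ = less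
... | tri≈ _ _ _ = equal
... | tri> _ _ _ = greater

<⇒compareℤ-less : ∀ {i j} → i < j → compareℤ i j ≡ less
<⇒compareℤ-less {i} {j} i<j with <-cmp i j
... | tri< _ _ _   = refl
... | tri≈ _ i≡j _ = ⊥-elim (<-irrefl i≡j i<j)
... | tri> _ _ j<i = ⊥-elim (<-asym i<j j<i)

>⇒compareℤ-greater : ∀ {i j} → j < i → compareℤ i j ≡ greater
>⇒compareℤ-greater {i} {j} j<i with <-cmp i j
... | tri< i<j _ _ = ⊥-elim (<-asym i<j j<i)
... | tri≈ _ i≡j _ = ⊥-elim (<-irrefl (sym i≡j) j<i)
... | tri> _ _ _   = refl

compareℤ-refl : ∀ i → compareℤ i i ≡ equal
compareℤ-refl i with <-cmp i i
... | tri< i<i _ _ = ⊥-elim (<-irrefl refl i<i)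
... | tri≈ _ _ _   = refl
... | tri> _ _ i<i = ⊥-elim (<-irrefl refl i<i)

compareℤ-equal⇒≡ : ∀ {i j} → compareℤ i j ≡ equal → i ≡ j
compareℤ-equal⇒≡ {i} {j} eq with <-cmp i j
... | tri≈ _ i≡j _ = i≡j

compareℤ-less⇒< : ∀ {i j} → compareℤ i j ≡ less → i < j
compareℤ-less⇒< {i} {j} eq with <-cmp i j
... | tri< i<j _ _ = i<j

compareℤ-converse : ∀ i j → compareℤ j i ≡ converse (compareℤ i j)
compareℤ-converse i j with <-cmp i j
... | tri< i<j _ _  = >⇒compareℤ-greater i<j
... | tri≈ _ refl _ = compareℤ-refl i
... | tri> _ _ j<i  = <⇒compareℤ-less j<i

compareℤ≢incomparable : ∀ {i j} → compareℤ i j ≢ incomparable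
compareℤ≢incomparable {i} {j} eq with <-cmp i j
compareℤ≢incomparable () | tri< _ _ _
compareℤ≢incomparable () | tri≈ _ _ _
compareℤ≢incomparable () | tri> _ _ _

isRight : ⊤ ⊎ ℤ → Bool
isRight (inj₁ _) = false
isRight (inj₂ _) = true

compare⊤⊎ℤ : ⊤ ⊎ ℤ → ⊤ ⊎ ℤ → Comparison
compare⊤⊎ℤ (inj₁ _) (inj₁ _) = equal
compare⊤⊎ℤ (inj₂ i) (inj₂ j) = compareℤ i j
compare⊤⊎ℤ _        _        = incomparable

ℤ⊔ℤ² : BlockOrder
ℤ⊔ℤ² = record
  { Block              = ⊤ ⊎ ℤ
  ; side               = isRight
  ; compare            = compare⊤⊎ℤ
  ; compare-refl       = λ { (inj₁ _) → refl ; (inj₂ i) → compareℤ-refl i }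
  ; compare-≡          = λ { {inj₁ _} {inj₁ _} _ → refl
                           ; {inj₂ _} {inj₂ _} eq → cong inj₂ (compareℤ-equal⇒≡ eq) }
  ; compare-converse   = λ { (inj₁ _) (inj₁ _) → refl
                           ; (inj₁ _) (inj₂ _) → refl
                           ; (inj₂ _) (inj₁ _) → refl
                           ; (inj₂ i) (inj₂ j) → compareℤ-converse i j }
  ; compare-trans      = λ { {inj₂ _} {inj₂ _} {inj₂ _} xy yz →
                               <⇒compareℤ-less (<-trans (compareℤ-less⇒< xy) (compareℤ-less⇒< yz))
                           ; {inj₂ _} {inj₂ _} {inj₁ _} _ () }
  ; incomparable⇒side≢ = λ { {inj₁ _} {inj₂ _} _ () ; {inj₂ _} {inj₁ _} _ ()
                           ; {inj₂ _} {inj₂ _} eq _ → compareℤ≢incomparable eq }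
  ; side≢⇒incomparable = λ { {inj₁ _} {inj₁ _} ne → ⊥-elim (ne refl)
                           ; {inj₁ _} {inj₂ _} _  → refl
                           ; {inj₂ _} {inj₁ _} _  → refl
                           ; {inj₂ _} {inj₂ _} ne → ⊥-elim (ne refl) }
  ; blockOn            = λ { false → inj₁ tt ; true → inj₂ 0ℤ }
  ; side-blockOn       = λ { false → refl ; true → refl }
  }

ℤ⊔ℤ-normal : Normal (Lex._≼_ ℤ⊔ℤ)
ℤ⊔ℤ-normal = _·_ , band , admissible
  where
  open Lex ℤ⊔ℤ using (_≼_)
  _·_ : Point ℤ⊔ℤ → Point ℤ⊔ℤ → Point ℤ⊔ℤ
  (_ , o) · (y , p) = y , o ⊓ p
  band : IsRightNormalBand _·_
  band = record
    { assoc       = λ (_ , o) (_ , p) (z , q) → cong (z ,_) (⊓-assoc o p q)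
    ; idem        = λ (x , o) → cong (x ,_) (⊓-idem o)
    ; rightNormal = λ (_ , o) (_ , p) (z , q) → cong (λ m → z , m ⊓ q) (⊓-comm o p)
    }
  admissible : Admissible _≼_ _·_
  admissible (false , _) (false , _) = mk⇔ (cong (false ,_) ∘ i≤j⇒i⊓j≡i) (i⊓j≡i⇒i≤j ∘ cong proj₂)
  admissible (true  , _) (true  , _) = mk⇔ (cong (true ,_) ∘ i≤j⇒i⊓j≡i) (i⊓j≡i⇒i≤j ∘ cong proj₂)
  admissible (false , _) (true  , _) = mk⇔ ⊥-elim λ ()
  admissible (true  , _) (false , _) = mk⇔ ⊥-elim λ ()

module _ where
  open Lex ℤ⊔ℤ² using (_≼_; ≼-trans; ≼-higher; ≼-same)

  ≼-inj₁-block : ∀ {v w} → proj₁ w ≡ inj₁ tt → v ≼ w →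
                 proj₁ v ≡ inj₁ tt × proj₂ v ≤ proj₂ w
  ≼-inj₁-block {inj₁ _ , _} {inj₁ _ , _} refl v≼w = refl , v≼w

  ≼-inj₂-block : ∀ {v i p} → v ≼ (inj₂ i , p) → ∃ λ j → proj₁ v ≡ inj₂ j
  ≼-inj₂-block {inj₂ j , _} _ = j , refl

  ℤ⊔ℤ²-not-normal : ¬ Normal _≼_
  ℤ⊔ℤ²-not-normal (_·_ , band , admissible) = ≤⇒≯ (proj₂ (u·x-left j)) 0<fj
    where
    open AdmissibleRightNormalBand band admissible

    x y : Point ℤ⊔ℤ²
    x = inj₁ tt , 0ℤ
    y = inj₂ 0ℤ , 0ℤ

    x·y-block : ∃ λ b → proj₁ (x · y) ≡ inj₂ b
    x·y-block = ≼-inj₂-block {x · y} (x·y≤y x y)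

    b : ℤ
    b = proj₁ x·y-block

    u : ℕ → Point ℤ⊔ℤ²
    u j = inj₂ (pred b) , + j

    u≼x·y : ∀ j → u j ≼ (x · y)
    u≼x·y j = subst (λ c → u j ≼ (c , proj₂ (x · y))) (sym (proj₂ x·y-block))
                    (≼-higher {inj₂ (pred b)} {inj₂ b} (<⇒compareℤ-less (i≤pred[j]⇒i<j ≤-refl)))

    f : ℕ → ℤ
    f j = proj₂ (u j · x)

    u·x-left : ∀ j → proj₁ (u j · x) ≡ inj₁ tt × f j ≤ 0ℤ
    u·x-left j = ≼-inj₁-block {u j · x} {x} refl
      (≼-trans {u j · x} {y · x} {x} (·-into (u≼x·y j)) (x·y≤y y x))

    f-mono : ∀ j → f j ≤ f (suc j)
    f-mono j = proj₂ (≼-inj₁-block {u j · x} {u (suc j) · x} (proj₁ (u·x-left (suc j)))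
                       (·-monoˡ-≤ x (≼-same {inj₂ (pred b)} (+≤+ (ℕ.n≤1+n j)))))

    f-injective : ∀ j → f j ≡ f (suc j) → u j ≡ u (suc j)
    f-injective j fj≡fsj = begin
      u j                  ≡⟨ ·-retraction (u≼x·y j) ⟨
      (u j · x) · y        ≡⟨ cong (_· y) u·x≡ ⟩
      (u (suc j) · x) · y  ≡⟨ ·-retraction (u≼x·y (suc j)) ⟩
      u (suc j)            ∎
      where
      open ≡-Reasoning
      u·x≡ : u j · x ≡ u (suc j) · x
      u·x≡ = cong₂ _,_ (trans (proj₁ (u·x-left j)) (sym (proj₁ (u·x-left (suc j))))) fj≡fsj

    f↑ : ∀ j → f j < f (suc j)
    f↑ j = ≤∧≢⇒< (f-mono j) (ℕ.1+n≢n ∘ sym ∘ cong (∣_∣ ∘ proj₂) ∘ f-injective j)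

    j : ℕ
    j = proj₁ (strictlyIncreasing⇒unbounded f f↑ 0ℤ)

    0<fj : 0ℤ < f j
    0<fj = proj₂ (strictlyIncreasing⇒unbounded f f↑ 0ℤ)

theorem4p4 : ¬ NormalPosetsAxiomatizable
theorem4p4 (T , axiomatizes) =
  ℤ⊔ℤ²-not-normal (proj₂ (Equivalence.from (axiomatizes _ _) ℤ⊔ℤ²⊨T))
  where
  ℤ⊔ℤ⊨T : ∀ φ → T φ → Lex._≼_ ℤ⊔ℤ ⊨ φ
  ℤ⊔ℤ⊨T = Equivalence.to (axiomatizes _ _) (Lex.≼-isPoset ℤ⊔ℤ , ℤ⊔ℤ-normal)
  ℤ⊔ℤ²⊨T : ∀ φ → T φ → Lex._≼_ ℤ⊔ℤ² ⊨ φ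
  ℤ⊔ℤ²⊨T φ = ⊨-transfer ℤ⊔ℤ ℤ⊔ℤ² φ ∘ ℤ⊔ℤ⊨T φ
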